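{- Let $\mathcal{A}$ be a finitely generated countable structure in a countable language. If $\mathcal{A}$ is not self-reflective, then $\mathcal{A}$ has a d-$\Sigma^0_2$ Scott sentence.
   Context: $\mathcal{L}_{\omega_1\omega}$ is the infinitary logic allowing countable conjunctions and disjunctions but only finite quantification. A formula is $\Sigma^0_0$ and $\Pi^0_0$ if it is finitary and quantifier-free; it is $\Sigma^0_\alpha$ if it is a countable disjunction of formulas $\exists \bar{x}\,\phi$ with each $\phi$ being $\Pi^0_\beta$ for some $\beta<\alpha$; it is $\Pi^0_\alpha$ if it is a countable conjunction of formulas $\forall \bar{x}\,\phi$ with each $\phi$ being $\Sigma^0_\beta$ for some $\beta<\alpha$; d-$\Sigma^0_\alpha$ means a conjunction of a $\Sigma^0_\alpha$ and a $\Pi^0_\alpha$ formula. A Scott sentence for a countable structure $\mathcal{A}$ is an $\mathcal{L}_{\omega_1\omega}$ sentence whose countable models are exactly the isomorphic copies of $\mathcal{A}$. For $\mathcal{B}\subseteq\mathcal{A}$, $\mathcal{B}\preceq_1\mathcal{A}$ means that for every existential formula $\varphi(\bar{x})$ and $\bar{b}\in\mathcal{B}$, $\mathcal{A}\models\varphi(\bar{b})$ iff $\mathcal{B}\models\varphi(\bar{b})$. A finitely generated structure $\mathcal{A}$ is self-reflective if it has a proper substructure $\mathcal{B}\preceq_1\mathcal{A}$ with $\mathcal{B}\cong\mathcal{A}$. -}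

module Defs where

open import Data.Nat using (ℕ; zero; suc)
open import Data.Fin using (Fin; zero; suc)
open import Data.Vec using (Vec; []; _∷_; map)
open import Data.Bool using (Bool; true)
open import Data.Product using (Σ; ∃; ∃-syntax; _×_; _,_; proj₁)
open import Data.Empty using (⊥)
open import Data.Unit using (⊤)
open import Relation.Nullary using (¬_)
open import Relation.Binary.PropositionalEquality using (_≡_)
open import Function using (_∘_)
open import Function.Definitions using (Injective)
open import Function.Bundles using (_↔_; _⇔_; Inverse)

Countable : Set → Set
Countable X = Σ (X → ℕ) λ f → Injective _≡_ _≡_ f

-- A (first-order) language: function symbols (constants = arity 0)
-- and relation symbols, each with an arity.
record Lang : Set₁ where
  field
    Fun   : Set
    funAr : Fun → ℕ
    Rel   : Set
    relAr : Rel → ℕ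

CountableLang : Lang → Set
CountableLang L = Countable (Lang.Fun L) × Countable (Lang.Rel L)

module _ (L : Lang) where
  open Lang L

  record Structure : Set₁ where
    field
      Carrier : Set
      fun     : (f : Fun) → Vec Carrier (funAr f) → Carrier
      rel     : (r : Rel) → Vec Carrier (relAr r) → Set

  open Structure

  CountableStr : Structure → Set
  CountableStr A = Countable (Carrier A)

  data Term (n : ℕ) : Set where
    var : Fin n → Term n
    app : (f : Fun) → Vec (Term n) (funAr f) → Term n

  -- L_{ω₁ω} formulas with free variables among Fin n (de Bruijn style);
  -- ⋀ / ⋁ are countable conjunctions / disjunctions (indexed by ℕ;
  -- finite and empty ones are obtained via repetition and ⊤'/⊥').
  data Formula (n : ℕ) : Set where
    ⊤' ⊥'   : Formula n
    _≐_     : Term n → Term n → Formula n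
    rel'    : (r : Rel) → Vec (Term n) (relAr r) → Formula n
    ¬'_     : Formula n → Formula n
    _∧'_    : Formula n → Formula n → Formula n
    _∨'_    : Formula n → Formula n → Formula n
    ⋀ ⋁     : (ℕ → Formula n) → Formula n
    ∀' ∃'   : Formula (suc n) → Formula n

  Sentence : Set
  Sentence = Formula 0

  ext : {C : Set} {n : ℕ} → C → (Fin n → C) → Fin (suc n) → C
  ext a ρ zero    = a
  ext a ρ (suc i) = ρ i

  module _ (A : Structure) where
    mutual
      evalT : ∀ {n} → Term n → (Fin n → Carrier A) → Carrier A
      evalT (var i)    ρ = ρ i
      evalT (app f ts) ρ = fun A f (evalTs ts ρ)

      evalTs : ∀ {n k} → Vec (Term n) k → (Fin n → Carrier A) → Vec (Carrier A) k
      evalTs []       ρ = []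
      evalTs (t ∷ ts) ρ = evalT t ρ ∷ evalTs ts ρ

    Sat : ∀ {n} → Formula n → (Fin n → Carrier A) → Set
    Sat ⊤'         ρ = ⊤
    Sat ⊥'         ρ = ⊥
    Sat (s ≐ t)    ρ = evalT s ρ ≡ evalT t ρ
    Sat (rel' r ts) ρ = rel A r (evalTs ts ρ)
    Sat (¬' φ)     ρ = ¬ Sat φ ρ
    Sat (φ ∧' ψ)   ρ = Sat φ ρ × Sat ψ ρ
    Sat (φ ∨' ψ)   ρ = Sat φ ρ Data.Sum.⊎ Sat ψ ρ
      where import Data.Sum
    Sat (⋀ φs)     ρ = ∀ i → Sat (φs i) ρ
    Sat (⋁ φs)     ρ = ∃[ i ] Sat (φs i) ρ
    Sat (∀' φ)     ρ = ∀ a → Sat φ (ext a ρ)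
    Sat (∃' φ)     ρ = ∃[ a ] Sat φ (ext a ρ)

  noVars : {C : Set} → Fin 0 → C
  noVars ()

  data QF {n : ℕ} : Formula n → Set where
    qf⊤ : QF ⊤'
    qf⊥ : QF ⊥'
    qf≐ : ∀ s t → QF (s ≐ t)
    qfR : ∀ r ts → QF (rel' r ts)
    qf¬ : ∀ {φ} → QF φ → QF (¬' φ)
    qf∧ : ∀ {φ ψ} → QF φ → QF ψ → QF (φ ∧' ψ)
    qf∨ : ∀ {φ ψ} → QF φ → QF ψ → QF (φ ∨' ψ)

  data ExBlock (P : ∀ {m} → Formula m → Set) : ∀ {n} → Formula n → Set where
    base : ∀ {n} {φ : Formula n} → P φ → ExBlock P φ
    step : ∀ {n} {φ : Formula (suc n)} → ExBlock P φ → ExBlock P (∃' φ)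

  data AllBlock (P : ∀ {m} → Formula m → Set) : ∀ {n} → Formula n → Set where
    base : ∀ {n} {φ : Formula n} → P φ → AllBlock P φ
    step : ∀ {n} {φ : Formula (suc n)} → AllBlock P φ → AllBlock P (∀' φ)

  data IsΣ1 {n : ℕ} : Formula n → Set where
    mk : (φs : ℕ → Formula n) → (∀ i → ExBlock QF (φs i)) → IsΣ1 (⋁ φs)

  data IsΠ1 {n : ℕ} : Formula n → Set where
    mk : (φs : ℕ → Formula n) → (∀ i → AllBlock QF (φs i)) → IsΠ1 (⋀ φs)

  Πbelow2 : ∀ {m} → Formula m → Set
  Πbelow2 φ = QF φ Data.Sum.⊎ IsΠ1 φ
    where import Data.Sum

  Σbelow2 : ∀ {m} → Formula m → Set
  Σbelow2 φ = QF φ Data.Sum.⊎ IsΣ1 φ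
    where import Data.Sum

  data IsΣ2 {n : ℕ} : Formula n → Set where
    mk : (φs : ℕ → Formula n) → (∀ i → ExBlock Πbelow2 (φs i)) → IsΣ2 (⋁ φs)

  data IsΠ2 {n : ℕ} : Formula n → Set where
    mk : (φs : ℕ → Formula n) → (∀ i → AllBlock Σbelow2 (φs i)) → IsΠ2 (⋀ φs)

  data IsDΣ2 {n : ℕ} : Formula n → Set where
    mk : ∀ {φ ψ} → IsΣ2 φ → IsΠ2 ψ → IsDΣ2 (φ ∧' ψ)

  Existential : ∀ {n} → Formula n → Set
  Existential = ExBlock QF

  record _≅_ (A B : Structure) : Set where
    field
      bij     : Carrier A ↔ Carrier B
    h : Carrier A → Carrier B
    h = Inverse.to bij
    field
      presFun : ∀ f (xs : Vec (Carrier A) (funAr f)) → h (fun A f xs) ≡ fun B f (map h xs)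
      presRel : ∀ r (xs : Vec (Carrier A) (relAr r)) → rel A r xs ⇔ rel B r (map h xs)

  record SubStr (A : Structure) : Set where
    field
      S      : Carrier A → Bool
      closed : ∀ f (xs : Vec (Σ (Carrier A) (λ a → S a ≡ true)) (funAr f)) →
               S (fun A f (map proj₁ xs)) ≡ true

  induced : (A : Structure) → SubStr A → Structure
  induced A B = record
    { Carrier = Σ (Carrier A) (λ a → SubStr.S B a ≡ true)
    ; fun     = λ f xs → fun A f (map proj₁ xs) , SubStr.closed B f xs
    ; rel     = λ r xs → rel A r (map proj₁ xs)
    }

  Proper : (A : Structure) → SubStr A → Set
  Proper A B = ∃[ a ] ¬ (SubStr.S B a ≡ true)

  _≼₁_ : {A : Structure} → SubStr A → Set
  _≼₁_ {A} B = ∀ {k} (φ : Formula k) → Existential φ →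
     (b : Fin k → Carrier (induced A B)) →
     (Sat A φ (proj₁ ∘ b) ⇔ Sat (induced A B) φ b)

  FinitelyGenerated : Structure → Set
  FinitelyGenerated A = ∃[ n ] Σ (Fin n → Carrier A) λ gens →
    ∀ a → ∃[ t ] evalT A {n} t gens ≡ a

  SelfReflective : Structure → Set
  SelfReflective A = ∃[ B ] (Proper A B × _≼₁_ {A} B × (induced A B ≅ A))

  ScottSentence : Structure → Sentence → Set₁
  ScottSentence A φ = (B : Structure) → CountableStr B → (Sat B φ noVars ⇔ (B ≅ A))

module Submission where

-- Fix generators g : Fin n → A.  Let Δ(x̄) be the Π⁰₁ formula "every
-- existential formula true of x̄ is true of g in A": the conjunction of
-- ∀ȳ ¬θ(x̄,ȳ) over all existential formulas ∃ȳ θ false of g.  Then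
--     Φ  =  ∃x̄ Δ(x̄)  ∧  ∀x̄ ∀y (¬Δ(x̄) ∨ ⋁ₜ y = t(x̄))
-- is d-Σ⁰₂.  If X ⊨ Δ(β), every quantifier-free fact of β holds of g, so if β
-- also generates X then X ≅ A; this gives: every model of Φ is a copy of A.
-- Conversely, if A ⊨ Δ(β) then ⟨β⟩ ≅ A and ⟨β⟩ ≼₁ A, so ⟨β⟩ = A as A is not
-- self-reflective; hence A ⊨ Φ, and so does every copy of A.

open import Defs
open import Data.Product using (Σ; ∃-syntax; _×_; _,_; proj₁; proj₂; uncurry)
open import Relation.Nullary using (¬_; Dec; yes; no; does; contradiction)
open import Axiom.ExcludedMiddle using (ExcludedMiddle)
open import Level using (0ℓ)
open import Axiom.DoubleNegationElimination using (em⇒dne)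
open import Axiom.UniquenessOfIdentityProofs using (module Decidable⇒UIP)
open import Data.Bool using (true)
open import Data.Bool.Properties using () renaming (_≟_ to _≟ᵇ_)
open import Data.Empty using (⊥-elim)
open import Data.Fin using (Fin) renaming (zero to fz; suc to fs)
open import Data.Maybe using (Maybe; just; nothing; _>>=_) renaming (map to mapMaybe)
open import Data.Nat using (ℕ; zero; suc; _+_; _≤_; s≤s; _⊔_)
open import Data.Nat.Properties
  using (+-suc; +-identityʳ; suc-injective; ≤-refl; ≤-trans; m≤m⊔n; m≤n⊔m)
open import Data.Sum using (_⊎_; inj₁; inj₂)
open import Data.Unit using (tt)
open import Data.Vec using (Vec; []; _∷_) renaming (map to mapVec)
open import Data.Vec.Relation.Unary.All using (All; []; _∷_; universal)
open import Function using (_∘_)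
open import Function.Bundles using (Equivalence; Inverse; mk⇔; mk↔ₛ′)
open import Relation.Nullary.Decidable using (dec-true)
open import Relation.Nullary.Negation using (¬∃⟶∀¬)
open import Relation.Binary.PropositionalEquality
  using (_≡_; refl; sym; trans; cong; cong₂; subst; module ≡-Reasoning)

nextPair : ℕ × ℕ → ℕ × ℕ
nextPair (a , suc b) = suc a , b
nextPair (a , zero)  = zero , suc a

-- The Cantor enumeration of ℕ × ℕ, anti-diagonal by anti-diagonal.
unpair : ℕ → ℕ × ℕ
unpair zero    = 0 , 0
unpair (suc i) = nextPair (unpair i)

-- Every pair on the anti-diagonal a + b = s is reached: walk back along the
-- diagonal (decreasing a) until its start (0 , s), which follows (s - 1 , 0).
unpair-onDiagonal : ∀ s a b → a + b ≡ s → ∃[ i ] unpair i ≡ (a , b)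
unpair-onDiagonal s zero zero _ = 0 , refl
unpair-onDiagonal s (suc a) b a+b≡s
  with i , p ← unpair-onDiagonal s a (suc b) (trans (+-suc a b) a+b≡s)
  = suc i , cong nextPair p
unpair-onDiagonal (suc s) zero (suc b) b≡s
  with i , p ← unpair-onDiagonal s b zero (trans (+-identityʳ b) (suc-injective b≡s))
  = suc i , cong nextPair p

unpair-surjective : ∀ a b → ∃[ i ] unpair i ≡ (a , b)
unpair-surjective a b = unpair-onDiagonal (a + b) a b refl

Enumerator : Set → Set
Enumerator X = ℕ → Maybe X

data _hits_ {X : Set} (e : Enumerator X) (x : X) : Set where
  at : (i : ℕ) → e i ≡ just x → e hits x

record Enumeration (X : Set) : Set where
  field
    enum     : Enumerator X
    complete : ∀ x → enum hits x
open Enumeration public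

module _ {X Y : Set} where

  _⟫=_ : Enumerator X → (X → Enumerator Y) → Enumerator Y
  (e ⟫= k) i = e (proj₁ (unpair i)) >>= λ x → k x (proj₂ (unpair i))

  ⟫=-hits : {e : Enumerator X} {k : X → Enumerator Y} {x : X} {y : Y} →
            e hits x → k x hits y → (e ⟫= k) hits y
  ⟫=-hits {e} {k} {x} {y} (at j ej≡x) (at l kl≡y) with i , ui≡jl ← unpair-surjective j l =
    at i (begin
      (e ⟫= k) i
        ≡⟨ cong (λ p → e (proj₁ p) >>= λ x′ → k x′ (proj₂ p)) ui≡jl ⟩
      (e j >>= λ x′ → k x′ l)
        ≡⟨ cong (_>>= λ x′ → k x′ l) ej≡x ⟩
      k x l
        ≡⟨ kl≡y ⟩
      just y ∎)
    where open ≡-Reasoning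

  mapE : (X → Y) → Enumerator X → Enumerator Y
  mapE f e = mapMaybe f ∘ e

  mapE-hits : (f : X → Y) {e : Enumerator X} {x : X} → e hits x → mapE f e hits f x
  mapE-hits f (at i ei≡x) = at i (cong (mapMaybe f) ei≡x)

  image-enumeration : (f : X → Y) → (∀ y → ∃[ x ] f x ≡ y) → Enumeration X → Enumeration Y
  image-enumeration f surj eX = record
    { enum     = mapE f (enum eX)
    ; complete = λ y → let x , fx≡y = surj y in
                       subst (mapE f (enum eX) hits_) fx≡y (mapE-hits f (complete eX x)) }

allℕ : Enumerator ℕ
allℕ = just

allℕ-hits : ∀ n → allℕ hits n
allℕ-hits n = at n refl

Fin-enumeration : ∀ k → Enumeration (Fin k)
Fin-enumeration k = record { enum = fins k ; complete = fins-hits }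
  where
  fins : ∀ k → Enumerator (Fin k)
  fins zero    _       = nothing
  fins (suc k) zero    = just fz
  fins (suc k) (suc i) = mapE fs (fins k) i
  fins-hits : ∀ {k} (x : Fin k) → fins k hits x
  fins-hits fz     = at 0 refl
  fins-hits (fs x) with at i p ← fins-hits x = at (suc i) (cong (mapMaybe fs) p)

Σ-enumeration : {X : Set} {Y : X → Set} →
                Enumeration X → (∀ x → Enumeration (Y x)) → Enumeration (Σ X Y)
Σ-enumeration eX eY = record
  { enum     = enum eX ⟫= λ x → mapE (x ,_) (enum (eY x))
  ; complete = λ (x , y) → ⟫=-hits (complete eX x) (mapE-hits (x ,_) (complete (eY x) y)) }

×-enumeration : {X Y : Set} → Enumeration X → Enumeration Y → Enumeration (X × Y)
×-enumeration eX eY = Σ-enumeration eX (λ _ → eY)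

⊎-enumeration : {X Y : Set} → Enumeration X → Enumeration Y → Enumeration (X ⊎ Y)
⊎-enumeration {X} {Y} eX eY = record { enum = allℕ ⟫= side ; complete = side-hits }
  where
  side : ℕ → Enumerator (X ⊎ Y)
  side zero    = mapE inj₁ (enum eX)
  side (suc _) = mapE inj₂ (enum eY)
  side-hits : ∀ z → (allℕ ⟫= side) hits z
  side-hits (inj₁ x) = ⟫=-hits {k = side} (allℕ-hits 0) (mapE-hits inj₁ (complete eX x))
  side-hits (inj₂ y) = ⟫=-hits {k = side} (allℕ-hits 1) (mapE-hits inj₂ (complete eY y))

vecE : {X : Set} → Enumerator X → ∀ m → Enumerator (Vec X m)
vecE e zero    = λ _ → just []
vecE e (suc m) = e ⟫= λ x → mapE (x ∷_) (vecE e m)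

vecE-hits : {X : Set} {e : Enumerator X} {m : ℕ} {xs : Vec X m} →
            All (e hits_) xs → vecE e m hits xs
vecE-hits []       = at 0 refl
vecE-hits (h ∷ hs) = ⟫=-hits h (mapE-hits _ (vecE-hits hs))

Vec-enumeration : {X : Set} → Enumeration X → ∀ m → Enumeration (Vec X m)
Vec-enumeration eX m = record
  { enum = vecE (enum eX) m ; complete = λ xs → vecE-hits (universal (complete eX) xs) }

-- Well-founded trees: a node of shape s has ar s subtrees.  Terms and
-- quantifier-free formulas are coded by such trees below.
data W (S : Set) (ar : S → ℕ) : Set where
  node : (s : S) → Vec (W S ar) (ar s) → W S ar

module _ {S : Set} {ar : S → ℕ} (eS : Enumeration S) where

  treesUpTo : ℕ → Enumerator (W S ar)
  treesUpTo zero    = λ _ → nothing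
  treesUpTo (suc d) = enum eS ⟫= λ s → mapE (node s) (vecE (treesUpTo d) (ar s))

  -- Hit at every sufficiently large depth; this monotonicity lets the
  -- subtrees of a node be listed at one common depth.
  EventuallyHit : W S ar → Set
  EventuallyHit w = ∃[ d ] (∀ d′ → d ≤ d′ → treesUpTo d′ hits w)

  eventuallyHit    : ∀ w → EventuallyHit w
  eventuallyHitAll : ∀ {m} (ws : Vec (W S ar) m) →
                     ∃[ d ] (∀ d′ → d ≤ d′ → All (treesUpTo d′ hits_) ws)
  eventuallyHit (node s ws) with d , hitsWs ← eventuallyHitAll ws = suc d , hitsNode
    where
    hitsNode : ∀ d′ → suc d ≤ d′ → treesUpTo d′ hits node s ws
    hitsNode (suc d′) (s≤s d≤d′) =
      ⟫=-hits (complete eS s) (mapE-hits (node s) (vecE-hits (hitsWs d′ d≤d′)))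
  eventuallyHitAll [] = 0 , λ _ _ → []
  eventuallyHitAll (w ∷ ws)
    with d₁ , hitsW ← eventuallyHit w | d₂ , hitsWs ← eventuallyHitAll ws =
    d₁ ⊔ d₂ , λ d′ le → hitsW d′ (≤-trans (m≤m⊔n d₁ d₂) le)
                      ∷ hitsWs d′ (≤-trans (m≤n⊔m d₁ d₂) le)

  W-enumeration : Enumeration (W S ar)
  W-enumeration = record { enum = allℕ ⟫= treesUpTo ; complete = hits }
    where
    hits : ∀ w → (allℕ ⟫= treesUpTo) hits w
    hits w with d , hitsW ← eventuallyHit w = ⟫=-hits {k = treesUpTo} (allℕ-hits d) (hitsW d ≤-refl)

countable⇒enumeration : ExcludedMiddle 0ℓ → {X : Set} → Countable X → Enumeration X
countable⇒enumeration lem {X} (code , code-injective) =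
  record { enum = λ i → decode i lem ; complete = λ x → at (code x) (decode-code x lem) }
  where
  decode : (i : ℕ) → Dec (∃[ x ] code x ≡ i) → Maybe X
  decode i (yes (x , _)) = just x
  decode i (no _)        = nothing
  decode-code : ∀ x (d : Dec (∃[ y ] code y ≡ code x)) → decode (code x) d ≡ just x
  decode-code x (yes (y , cy≡cx)) = cong just (code-injective cy≡cx)
  decode-code x (no ∄y)           = contradiction (x , refl) ∄y

does-true⇒ : {P : Set} (d : Dec P) → does d ≡ true → P
does-true⇒ (yes p) _ = p

module _ (L : Lang) where
  open Lang L
  open Structure

  subT  : ∀ {k j} → (Fin k → Term L j) → Term L k → Term L j
  subTs : ∀ {k j m} → (Fin k → Term L j) → Vec (Term L k) m → Vec (Term L j) m
  subT σ (var x)    = σ x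
  subT σ (app f ts) = app f (subTs σ ts)
  subTs σ []       = []
  subTs σ (t ∷ ts) = subT σ t ∷ subTs σ ts

  wk : ∀ {k} → Term L k → Term L (suc k)
  wk = subT (var ∘ fs)

  liftSub : ∀ {k j} → (Fin k → Term L j) → Fin (suc k) → Term L (suc j)
  liftSub σ fz     = var fz
  liftSub σ (fs i) = wk (σ i)

  subF : ∀ {k j} → (Fin k → Term L j) → Formula L k → Formula L j
  subF σ ⊤'          = ⊤'
  subF σ ⊥'          = ⊥'
  subF σ (t ≐ u)     = subT σ t ≐ subT σ u
  subF σ (rel' r ts) = rel' r (subTs σ ts)
  subF σ (¬' φ)      = ¬' (subF σ φ)
  subF σ (φ ∧' ψ)    = subF σ φ ∧' subF σ ψ
  subF σ (φ ∨' ψ)    = subF σ φ ∨' subF σ ψ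
  subF σ (⋀ φs)      = ⋀ (λ i → subF σ (φs i))
  subF σ (⋁ φs)      = ⋁ (λ i → subF σ (φs i))
  subF σ (∀' φ)      = ∀' (subF (liftSub σ) φ)
  subF σ (∃' φ)      = ∃' (subF (liftSub σ) φ)

  subF-QF : ∀ {k j} (σ : Fin k → Term L j) {φ : Formula L k} → QF L φ → QF L (subF σ φ)
  subF-QF σ qf⊤         = qf⊤
  subF-QF σ qf⊥         = qf⊥
  subF-QF σ (qf≐ t u)   = qf≐ _ _
  subF-QF σ (qfR r ts)  = qfR r _
  subF-QF σ (qf¬ q)     = qf¬ (subF-QF σ q)
  subF-QF σ (qf∧ q q′)  = qf∧ (subF-QF σ q) (subF-QF σ q′)
  subF-QF σ (qf∨ q q′)  = qf∨ (subF-QF σ q) (subF-QF σ q′)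

  subF-existential : ∀ {k j} (σ : Fin k → Term L j) {φ : Formula L k} →
                     Existential L φ → Existential L (subF σ φ)
  subF-existential σ (base q) = base (subF-QF σ q)
  subF-existential σ (step b) = step (subF-existential (liftSub σ) b)

  closeEx closeAll : ∀ n → Formula L n → Formula L 0
  closeEx zero    φ = φ
  closeEx (suc n) φ = closeEx n (∃' φ)
  closeAll zero    φ = φ
  closeAll (suc n) φ = closeAll n (∀' φ)

  closeEx-block : ∀ {P : ∀ {m} → Formula L m → Set} n {φ : Formula L n} →
                  ExBlock L P φ → ExBlock L P (closeEx n φ)
  closeEx-block zero    b = b
  closeEx-block (suc n) b = closeEx-block n (step b)

  closeAll-block : ∀ {P : ∀ {m} → Formula L m → Set} n {φ : Formula L n} →
                   AllBlock L P φ → AllBlock L P (closeAll n φ)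
  closeAll-block zero    b = b
  closeAll-block (suc n) b = closeAll-block n (step b)

  module Semantics (X : Structure L) where

    evalT-cong  : ∀ {k} (t : Term L k) {ρ ρ′ : Fin k → Carrier X} →
                  (∀ i → ρ i ≡ ρ′ i) → evalT L X t ρ ≡ evalT L X t ρ′
    evalTs-cong : ∀ {k m} (ts : Vec (Term L k) m) {ρ ρ′ : Fin k → Carrier X} →
                  (∀ i → ρ i ≡ ρ′ i) → evalTs L X ts ρ ≡ evalTs L X ts ρ′
    evalT-cong (var x)    ρ≗ρ′ = ρ≗ρ′ x
    evalT-cong (app f ts) ρ≗ρ′ = cong (fun X f) (evalTs-cong ts ρ≗ρ′)
    evalTs-cong []       ρ≗ρ′ = refl
    evalTs-cong (t ∷ ts) ρ≗ρ′ = cong₂ _∷_ (evalT-cong t ρ≗ρ′) (evalTs-cong ts ρ≗ρ′)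

    ext-cong : ∀ {k} (a : Carrier X) {ρ ρ′ : Fin k → Carrier X} →
               (∀ i → ρ i ≡ ρ′ i) → ∀ i → ext L a ρ i ≡ ext L a ρ′ i
    ext-cong a ρ≗ρ′ fz     = refl
    ext-cong a ρ≗ρ′ (fs i) = ρ≗ρ′ i

    Sat-cong : ∀ {k} (φ : Formula L k) {ρ ρ′ : Fin k → Carrier X} →
               (∀ i → ρ i ≡ ρ′ i) → Sat L X φ ρ → Sat L X φ ρ′
    Sat-cong ⊤'          ρ≗ρ′ s = s
    Sat-cong ⊥'          ρ≗ρ′ s = s
    Sat-cong (t ≐ u)     ρ≗ρ′ s = trans (sym (evalT-cong t ρ≗ρ′)) (trans s (evalT-cong u ρ≗ρ′))
    Sat-cong (rel' r ts) ρ≗ρ′ s = subst (rel X r) (evalTs-cong ts ρ≗ρ′) s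
    Sat-cong (¬' φ)      ρ≗ρ′ s = λ s′ → s (Sat-cong φ (sym ∘ ρ≗ρ′) s′)
    Sat-cong (φ ∧' ψ)    ρ≗ρ′ (s , s′) = Sat-cong φ ρ≗ρ′ s , Sat-cong ψ ρ≗ρ′ s′
    Sat-cong (φ ∨' ψ)    ρ≗ρ′ (inj₁ s) = inj₁ (Sat-cong φ ρ≗ρ′ s)
    Sat-cong (φ ∨' ψ)    ρ≗ρ′ (inj₂ s) = inj₂ (Sat-cong ψ ρ≗ρ′ s)
    Sat-cong (⋀ φs)      ρ≗ρ′ s        = λ i → Sat-cong (φs i) ρ≗ρ′ (s i)
    Sat-cong (⋁ φs)      ρ≗ρ′ (i , s)  = i , Sat-cong (φs i) ρ≗ρ′ s
    Sat-cong (∀' φ)      ρ≗ρ′ s        = λ a → Sat-cong φ (ext-cong a ρ≗ρ′) (s a)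
    Sat-cong (∃' φ)      ρ≗ρ′ (a , s)  = a , Sat-cong φ (ext-cong a ρ≗ρ′) s

    evalSub : ∀ {k j} → (Fin k → Term L j) → (Fin j → Carrier X) → Fin k → Carrier X
    evalSub σ ρ i = evalT L X (σ i) ρ

    evalT-sub  : ∀ {k j} (σ : Fin k → Term L j) (t : Term L k) (ρ : Fin j → Carrier X) →
                 evalT L X (subT σ t) ρ ≡ evalT L X t (evalSub σ ρ)
    evalTs-sub : ∀ {k j m} (σ : Fin k → Term L j) (ts : Vec (Term L k) m)
                 (ρ : Fin j → Carrier X) → evalTs L X (subTs σ ts) ρ ≡ evalTs L X ts (evalSub σ ρ)
    evalT-sub σ (var x)    ρ = refl
    evalT-sub σ (app f ts) ρ = cong (fun X f) (evalTs-sub σ ts ρ)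
    evalTs-sub σ []       ρ = refl
    evalTs-sub σ (t ∷ ts) ρ = cong₂ _∷_ (evalT-sub σ t ρ) (evalTs-sub σ ts ρ)

    evalSub-lift : ∀ {k j} (σ : Fin k → Term L j) (a : Carrier X) (ρ : Fin j → Carrier X) →
                   ∀ i → evalSub (liftSub σ) (ext L a ρ) i ≡ ext L a (evalSub σ ρ) i
    evalSub-lift σ a ρ fz     = refl
    evalSub-lift σ a ρ (fs i) = evalT-sub (var ∘ fs) (σ i) (ext L a ρ)

    subF-to   : ∀ {k j} (σ : Fin k → Term L j) (φ : Formula L k) (ρ : Fin j → Carrier X) →
                Sat L X (subF σ φ) ρ → Sat L X φ (evalSub σ ρ)
    subF-from : ∀ {k j} (σ : Fin k → Term L j) (φ : Formula L k) (ρ : Fin j → Carrier X) →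
                Sat L X φ (evalSub σ ρ) → Sat L X (subF σ φ) ρ
    subF-to σ ⊤'          ρ s = s
    subF-to σ ⊥'          ρ s = s
    subF-to σ (t ≐ u)     ρ s = trans (sym (evalT-sub σ t ρ)) (trans s (evalT-sub σ u ρ))
    subF-to σ (rel' r ts) ρ s = subst (rel X r) (evalTs-sub σ ts ρ) s
    subF-to σ (¬' φ)      ρ s = λ s′ → s (subF-from σ φ ρ s′)
    subF-to σ (φ ∧' ψ)    ρ (s , s′) = subF-to σ φ ρ s , subF-to σ ψ ρ s′
    subF-to σ (φ ∨' ψ)    ρ (inj₁ s) = inj₁ (subF-to σ φ ρ s)
    subF-to σ (φ ∨' ψ)    ρ (inj₂ s) = inj₂ (subF-to σ ψ ρ s)
    subF-to σ (⋀ φs)      ρ s        = λ i → subF-to σ (φs i) ρ (s i)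
    subF-to σ (⋁ φs)      ρ (i , s)  = i , subF-to σ (φs i) ρ s
    subF-to σ (∀' φ)      ρ s        =
      λ a → Sat-cong φ (evalSub-lift σ a ρ) (subF-to (liftSub σ) φ (ext L a ρ) (s a))
    subF-to σ (∃' φ)      ρ (a , s)  =
      a , Sat-cong φ (evalSub-lift σ a ρ) (subF-to (liftSub σ) φ (ext L a ρ) s)
    subF-from σ ⊤'          ρ s = s
    subF-from σ ⊥'          ρ s = s
    subF-from σ (t ≐ u)     ρ s = trans (evalT-sub σ t ρ) (trans s (sym (evalT-sub σ u ρ)))
    subF-from σ (rel' r ts) ρ s = subst (rel X r) (sym (evalTs-sub σ ts ρ)) s
    subF-from σ (¬' φ)      ρ s = λ s′ → s (subF-to σ φ ρ s′)
    subF-from σ (φ ∧' ψ)    ρ (s , s′) = subF-from σ φ ρ s , subF-from σ ψ ρ s′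
    subF-from σ (φ ∨' ψ)    ρ (inj₁ s) = inj₁ (subF-from σ φ ρ s)
    subF-from σ (φ ∨' ψ)    ρ (inj₂ s) = inj₂ (subF-from σ ψ ρ s)
    subF-from σ (⋀ φs)      ρ s        = λ i → subF-from σ (φs i) ρ (s i)
    subF-from σ (⋁ φs)      ρ (i , s)  = i , subF-from σ (φs i) ρ s
    subF-from σ (∀' φ)      ρ s        =
      λ a → subF-from (liftSub σ) φ (ext L a ρ) (Sat-cong φ (sym ∘ evalSub-lift σ a ρ) (s a))
    subF-from σ (∃' φ)      ρ (a , s)  =
      a , subF-from (liftSub σ) φ (ext L a ρ) (Sat-cong φ (sym ∘ evalSub-lift σ a ρ) s)

    closeEx-elim : ∀ n (φ : Formula L n) (ρ : Fin 0 → Carrier X) →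
                   Sat L X (closeEx n φ) ρ → Σ (Fin n → Carrier X) (Sat L X φ)
    closeEx-elim zero    φ ρ s = ρ , s
    closeEx-elim (suc n) φ ρ s with β , a , s′ ← closeEx-elim n (∃' φ) ρ s = ext L a β , s′

    closeEx-intro : ∀ n (φ : Formula L n) (ρ : Fin 0 → Carrier X) (β : Fin n → Carrier X) →
                    Sat L X φ β → Sat L X (closeEx n φ) ρ
    closeEx-intro zero    φ ρ β s = Sat-cong φ (λ ()) s
    closeEx-intro (suc n) φ ρ β s =
      closeEx-intro n (∃' φ) ρ (β ∘ fs) (β fz , Sat-cong φ (λ { fz → refl ; (fs i) → refl }) s)

    closeAll-elim : ∀ n (φ : Formula L n) (ρ : Fin 0 → Carrier X) →
                    Sat L X (closeAll n φ) ρ → (β : Fin n → Carrier X) → Sat L X φ β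
    closeAll-elim zero    φ ρ s β = Sat-cong φ (λ ()) s
    closeAll-elim (suc n) φ ρ s β =
      Sat-cong φ (λ { fz → refl ; (fs i) → refl }) (closeAll-elim n (∀' φ) ρ s (β ∘ fs) (β fz))

    closeAll-intro : ∀ n (φ : Formula L n) (ρ : Fin 0 → Carrier X) →
                     ((β : Fin n → Carrier X) → Sat L X φ β) → Sat L X (closeAll n φ) ρ
    closeAll-intro zero    φ ρ h = h ρ
    closeAll-intro (suc n) φ ρ h = closeAll-intro n (∀' φ) ρ (λ β a → h (ext L a β))

  open Semantics

  -- Codes for terms, quantifier-free formulas and existential formulas, with
  -- enumerations; this is where countability of the language enters.
  module Codes (funE : Enumeration Fun) (relE : Enumeration Rel) where

    TermShape : ℕ → Set
    TermShape k = Fin k ⊎ Fun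

    termArity : ∀ {k} → TermShape k → ℕ
    termArity (inj₁ _) = 0
    termArity (inj₂ f) = funAr f

    treeToTerm  : ∀ {k} → W (TermShape k) termArity → Term L k
    treeToTerms : ∀ {k m} → Vec (W (TermShape k) termArity) m → Vec (Term L k) m
    treeToTerm (node (inj₁ x) []) = var x
    treeToTerm (node (inj₂ f) ws) = app f (treeToTerms ws)
    treeToTerms []       = []
    treeToTerms (w ∷ ws) = treeToTerm w ∷ treeToTerms ws

    treeOf  : ∀ {k} (t : Term L k) → ∃[ w ] treeToTerm w ≡ t
    treesOf : ∀ {k m} (ts : Vec (Term L k) m) → ∃[ ws ] treeToTerms ws ≡ ts
    treeOf (var x) = node (inj₁ x) [] , refl
    treeOf (app f ts) with ws , ws↦ts ← treesOf ts = node (inj₂ f) ws , cong (app f) ws↦ts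
    treesOf [] = [] , refl
    treesOf (t ∷ ts) with w , w↦t ← treeOf t | ws , ws↦ts ← treesOf ts =
      w ∷ ws , cong₂ _∷_ w↦t ws↦ts

    Term-enumeration : ∀ k → Enumeration (Term L k)
    Term-enumeration k = image-enumeration treeToTerm treeOf
      (W-enumeration (⊎-enumeration (Fin-enumeration k) funE))

    data QFShape (k : ℕ) : Set where
      falsity truth                    : QFShape k
      equation                         : Term L k → Term L k → QFShape k
      relation                         : (r : Rel) → Vec (Term L k) (relAr r) → QFShape k
      negation conjunction disjunction : QFShape k

    qfArity : ∀ {k} → QFShape k → ℕ
    qfArity negation    = 1
    qfArity conjunction = 2
    qfArity disjunction = 2
    qfArity _           = 0

    QFCode : ℕ → Set
    QFCode k = W (QFShape k) qfArity

    ⟦_⟧ : ∀ {k} → QFCode k → Formula L k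
    ⟦ node falsity []                ⟧ = ⊥'
    ⟦ node truth []                  ⟧ = ⊤'
    ⟦ node (equation t u) []         ⟧ = t ≐ u
    ⟦ node (relation r ts) []        ⟧ = rel' r ts
    ⟦ node negation (θ ∷ [])         ⟧ = ¬' ⟦ θ ⟧
    ⟦ node conjunction (θ ∷ θ′ ∷ []) ⟧ = ⟦ θ ⟧ ∧' ⟦ θ′ ⟧
    ⟦ node disjunction (θ ∷ θ′ ∷ []) ⟧ = ⟦ θ ⟧ ∨' ⟦ θ′ ⟧

    ⟦⟧-QF : ∀ {k} (θ : QFCode k) → QF L ⟦ θ ⟧
    ⟦⟧-QF (node falsity [])                = qf⊥
    ⟦⟧-QF (node truth [])                  = qf⊤
    ⟦⟧-QF (node (equation t u) [])         = qf≐ t u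
    ⟦⟧-QF (node (relation r ts) [])        = qfR r ts
    ⟦⟧-QF (node negation (θ ∷ []))         = qf¬ (⟦⟧-QF θ)
    ⟦⟧-QF (node conjunction (θ ∷ θ′ ∷ [])) = qf∧ (⟦⟧-QF θ) (⟦⟧-QF θ′)
    ⟦⟧-QF (node disjunction (θ ∷ θ′ ∷ [])) = qf∨ (⟦⟧-QF θ) (⟦⟧-QF θ′)

    encodeQF : ∀ {k} {φ : Formula L k} → QF L φ → ∃[ θ ] ⟦ θ ⟧ ≡ φ
    encodeQF qf⊤        = node truth [] , refl
    encodeQF qf⊥        = node falsity [] , refl
    encodeQF (qf≐ t u)  = node (equation t u) [] , refl
    encodeQF (qfR r ts) = node (relation r ts) [] , refl
    encodeQF (qf¬ q) with θ , θ↦φ ← encodeQF q = node negation (θ ∷ []) , cong ¬'_ θ↦φ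
    encodeQF (qf∧ q q′) with θ , θ↦φ ← encodeQF q | θ′ , θ′↦ψ ← encodeQF q′ =
      node conjunction (θ ∷ θ′ ∷ []) , cong₂ _∧'_ θ↦φ θ′↦ψ
    encodeQF (qf∨ q q′) with θ , θ↦φ ← encodeQF q | θ′ , θ′↦ψ ← encodeQF q′ =
      node disjunction (θ ∷ θ′ ∷ []) , cong₂ _∨'_ θ↦φ θ′↦ψ

    QFShape-enumeration : ∀ k → Enumeration (QFShape k)
    QFShape-enumeration k = record { enum = allℕ ⟫= shapes ; complete = shapes-hits }
      where
      terms = Term-enumeration k
      equations = ×-enumeration terms terms
      atoms = Σ-enumeration relE (λ r → Vec-enumeration terms (relAr r))
      shapes : ℕ → Enumerator (QFShape k)
      shapes 0 = λ _ → just falsity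
      shapes 1 = λ _ → just truth
      shapes 2 = mapE (uncurry equation) (enum equations)
      shapes 3 = mapE (uncurry relation) (enum atoms)
      shapes 4 = λ _ → just negation
      shapes 5 = λ _ → just conjunction
      shapes _ = λ _ → just disjunction
      shapes-hits : ∀ s → (allℕ ⟫= shapes) hits s
      shapes-hits falsity        = ⟫=-hits {k = shapes} (allℕ-hits 0) (at 0 refl)
      shapes-hits truth          = ⟫=-hits {k = shapes} (allℕ-hits 1) (at 0 refl)
      shapes-hits (equation t u) = ⟫=-hits {k = shapes} (allℕ-hits 2)
        (mapE-hits (uncurry equation) (complete equations (t , u)))
      shapes-hits (relation r ts) = ⟫=-hits {k = shapes} (allℕ-hits 3)
        (mapE-hits (uncurry relation) (complete atoms (r , ts)))
      shapes-hits negation       = ⟫=-hits {k = shapes} (allℕ-hits 4) (at 0 refl)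
      shapes-hits conjunction    = ⟫=-hits {k = shapes} (allℕ-hits 5) (at 0 refl)
      shapes-hits disjunction    = ⟫=-hits {k = shapes} (allℕ-hits 6) (at 0 refl)

    QFCode-enumeration : ∀ k → Enumeration (QFCode k)
    QFCode-enumeration k = W-enumeration (QFShape-enumeration k)

    data ExCode (k : ℕ) : Set where
      qf : QFCode k → ExCode k
      ∃ᶜ : ExCode (suc k) → ExCode k

    ⟪_⟫ : ∀ {k} → ExCode k → Formula L k
    ⟪ qf θ ⟫ = ⟦ θ ⟧
    ⟪ ∃ᶜ c ⟫ = ∃' ⟪ c ⟫

    ⟪_⟫ᶜ : ∀ {k} → ExCode k → Formula L k
    ⟪ qf θ ⟫ᶜ = ¬' ⟦ θ ⟧
    ⟪ ∃ᶜ c ⟫ᶜ = ∀' ⟪ c ⟫ᶜ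

    ⟪⟫-existential : ∀ {k} (c : ExCode k) → Existential L ⟪ c ⟫
    ⟪⟫-existential (qf θ) = base (⟦⟧-QF θ)
    ⟪⟫-existential (∃ᶜ c) = step (⟪⟫-existential c)

    ⟪⟫ᶜ-universal : ∀ {k} (c : ExCode k) → AllBlock L (QF L) ⟪ c ⟫ᶜ
    ⟪⟫ᶜ-universal (qf θ) = base (qf¬ (⟦⟧-QF θ))
    ⟪⟫ᶜ-universal (∃ᶜ c) = step (⟪⟫ᶜ-universal c)

    encodeEx : ∀ {k} {φ : Formula L k} → Existential L φ → ∃[ c ] ⟪ c ⟫ ≡ φ
    encodeEx (base q) with θ , θ↦φ ← encodeQF q = qf θ , θ↦φ
    encodeEx (step b) with c , c↦φ ← encodeEx b = ∃ᶜ c , cong ∃' c↦φ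

    -- ⟪ c ⟫ᶜ means ¬ ⟪ c ⟫ (constructively: ¬∃ is ∀¬).
    ⟪⟫ᶜ⇒¬ : (X : Structure L) {k : ℕ} (c : ExCode k) {ρ : Fin k → Carrier X} →
            Sat L X ⟪ c ⟫ᶜ ρ → ¬ Sat L X ⟪ c ⟫ ρ
    ⟪⟫ᶜ⇒¬ X (qf θ) ¬θ θ[ρ]          = ¬θ θ[ρ]
    ⟪⟫ᶜ⇒¬ X (∃ᶜ c) ∀¬c (a , c[a]) = ⟪⟫ᶜ⇒¬ X c (∀¬c a) c[a]

    ¬⇒⟪⟫ᶜ : (X : Structure L) {k : ℕ} (c : ExCode k) {ρ : Fin k → Carrier X} →
            ¬ Sat L X ⟪ c ⟫ ρ → Sat L X ⟪ c ⟫ᶜ ρ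
    ¬⇒⟪⟫ᶜ X (qf θ) ¬θ  = ¬θ
    ¬⇒⟪⟫ᶜ X (∃ᶜ c) ¬∃c = λ a → ¬⇒⟪⟫ᶜ X c (λ c[a] → ¬∃c (a , c[a]))

    exCodes : ℕ → ∀ {k} → Enumerator (ExCode k)
    exCodes zero    {k} = mapE qf (enum (QFCode-enumeration k))
    exCodes (suc m)     = mapE ∃ᶜ (exCodes m)

    quantifiers : ∀ {k} → ExCode k → ℕ
    quantifiers (qf _) = 0
    quantifiers (∃ᶜ c) = suc (quantifiers c)

    exCodes-hits : ∀ {k} (c : ExCode k) → exCodes (quantifiers c) hits c
    exCodes-hits {k} (qf θ) = mapE-hits qf (complete (QFCode-enumeration k) θ)
    exCodes-hits (∃ᶜ c)     = mapE-hits ∃ᶜ (exCodes-hits c)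

    ExCode-enumeration : ∀ k → Enumeration (ExCode k)
    ExCode-enumeration k = record
      { enum     = allℕ ⟫= λ m → exCodes m
      ; complete = λ c →
          ⟫=-hits {k = λ m → exCodes m} (allℕ-hits (quantifiers c)) (exCodes-hits c) }

  module IsoTransfer {X Y : Structure L} (I : _≅_ L X Y) where
    h : Carrier X → Carrier Y
    h = Inverse.to (_≅_.bij I)

    h⁻¹ : Carrier Y → Carrier X
    h⁻¹ = Inverse.from (_≅_.bij I)

    h-h⁻¹ : ∀ b → h (h⁻¹ b) ≡ b
    h-h⁻¹ = Inverse.strictlyInverseˡ (_≅_.bij I)

    h⁻¹-h : ∀ a → h⁻¹ (h a) ≡ a
    h⁻¹-h = Inverse.strictlyInverseʳ (_≅_.bij I)

    h-injective : ∀ {a b} → h a ≡ h b → a ≡ b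
    h-injective {a} {b} ha≡hb = trans (sym (h⁻¹-h a)) (trans (cong h⁻¹ ha≡hb) (h⁻¹-h b))

    evalT-iso  : ∀ {k} (t : Term L k) (ρ : Fin k → Carrier X) →
                 h (evalT L X t ρ) ≡ evalT L Y t (h ∘ ρ)
    evalTs-iso : ∀ {k m} (ts : Vec (Term L k) m) (ρ : Fin k → Carrier X) →
                 mapVec h (evalTs L X ts ρ) ≡ evalTs L Y ts (h ∘ ρ)
    evalT-iso (var x)    ρ = refl
    evalT-iso (app f ts) ρ = trans (_≅_.presFun I f _) (cong (fun Y f) (evalTs-iso ts ρ))
    evalTs-iso []       ρ = refl
    evalTs-iso (t ∷ ts) ρ = cong₂ _∷_ (evalT-iso t ρ) (evalTs-iso ts ρ)

    h-ext : ∀ {k} (a : Carrier X) (ρ : Fin k → Carrier X) →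
            ∀ i → h (ext L a ρ i) ≡ ext L (h a) (h ∘ ρ) i
    h-ext a ρ fz     = refl
    h-ext a ρ (fs i) = refl

    preserves : ∀ {k} (φ : Formula L k) (ρ : Fin k → Carrier X) →
                Sat L X φ ρ → Sat L Y φ (h ∘ ρ)
    reflects  : ∀ {k} (φ : Formula L k) (ρ : Fin k → Carrier X) →
                Sat L Y φ (h ∘ ρ) → Sat L X φ ρ
    preserves ⊤'          ρ s = s
    preserves ⊥'          ρ s = s
    preserves (t ≐ u)     ρ s = trans (sym (evalT-iso t ρ)) (trans (cong h s) (evalT-iso u ρ))
    preserves (rel' r ts) ρ s =
      subst (rel Y r) (evalTs-iso ts ρ) (Equivalence.to (_≅_.presRel I r _) s)
    preserves (¬' φ)      ρ s = λ s′ → s (reflects φ ρ s′)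
    preserves (φ ∧' ψ)    ρ (s , s′) = preserves φ ρ s , preserves ψ ρ s′
    preserves (φ ∨' ψ)    ρ (inj₁ s) = inj₁ (preserves φ ρ s)
    preserves (φ ∨' ψ)    ρ (inj₂ s) = inj₂ (preserves ψ ρ s)
    preserves (⋀ φs)      ρ s        = λ i → preserves (φs i) ρ (s i)
    preserves (⋁ φs)      ρ (i , s)  = i , preserves (φs i) ρ s
    preserves (∀' φ)      ρ s        = λ b →
      Sat-cong Y φ (λ { fz → h-h⁻¹ b ; (fs i) → refl })
        (preserves φ (ext L (h⁻¹ b) ρ) (s (h⁻¹ b)))
    preserves (∃' φ)      ρ (a , s)  =
      h a , Sat-cong Y φ (h-ext a ρ) (preserves φ (ext L a ρ) s)
    reflects ⊤'          ρ s = s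
    reflects ⊥'          ρ s = s
    reflects (t ≐ u)     ρ s = h-injective (trans (evalT-iso t ρ) (trans s (sym (evalT-iso u ρ))))
    reflects (rel' r ts) ρ s =
      Equivalence.from (_≅_.presRel I r _) (subst (rel Y r) (sym (evalTs-iso ts ρ)) s)
    reflects (¬' φ)      ρ s = λ s′ → s (preserves φ ρ s′)
    reflects (φ ∧' ψ)    ρ (s , s′) = reflects φ ρ s , reflects ψ ρ s′
    reflects (φ ∨' ψ)    ρ (inj₁ s) = inj₁ (reflects φ ρ s)
    reflects (φ ∨' ψ)    ρ (inj₂ s) = inj₂ (reflects ψ ρ s)
    reflects (⋀ φs)      ρ s        = λ i → reflects (φs i) ρ (s i)
    reflects (⋁ φs)      ρ (i , s)  = i , reflects (φs i) ρ s
    reflects (∀' φ)      ρ s        = λ a →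
      reflects φ (ext L a ρ) (Sat-cong Y φ (sym ∘ h-ext a ρ) (s (h a)))
    reflects (∃' φ)      ρ (b , s)  = h⁻¹ b , reflects φ (ext L (h⁻¹ b) ρ)
      (Sat-cong Y φ (λ { fz → sym (h-h⁻¹ b) ; (fs i) → refl }) s)

  module SubstructureFacts (A : Structure L) (B : SubStr L A) where

    B̂ : Structure L
    B̂ = induced L A B

    -- Elements of B are determined by their underlying elements of A
    -- (membership is Bool-valued, so its proofs are unique).
    ∈B-unique : {x y : Carrier B̂} → proj₁ x ≡ proj₁ y → x ≡ y
    ∈B-unique {a , p} {.a , q} refl = cong (a ,_) (Decidable⇒UIP.≡-irrelevant _≟ᵇ_ p q)

    evalT-induced  : ∀ {k} (t : Term L k) (ρ : Fin k → Carrier B̂) →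
                     proj₁ (evalT L B̂ t ρ) ≡ evalT L A t (proj₁ ∘ ρ)
    evalTs-induced : ∀ {k m} (ts : Vec (Term L k) m) (ρ : Fin k → Carrier B̂) →
                     mapVec proj₁ (evalTs L B̂ ts ρ) ≡ evalTs L A ts (proj₁ ∘ ρ)
    evalT-induced (var x)    ρ = refl
    evalT-induced (app f ts) ρ = cong (fun A f) (evalTs-induced ts ρ)
    evalTs-induced []       ρ = refl
    evalTs-induced (t ∷ ts) ρ = cong₂ _∷_ (evalT-induced t ρ) (evalTs-induced ts ρ)

    QF-up   : ∀ {k} {φ : Formula L k} → QF L φ → (ρ : Fin k → Carrier B̂) →
              Sat L B̂ φ ρ → Sat L A φ (proj₁ ∘ ρ)
    QF-down : ∀ {k} {φ : Formula L k} → QF L φ → (ρ : Fin k → Carrier B̂) →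
              Sat L A φ (proj₁ ∘ ρ) → Sat L B̂ φ ρ
    QF-up qf⊤         ρ s = s
    QF-up qf⊥         ρ s = s
    QF-up (qf≐ t u)   ρ s = trans (sym (evalT-induced t ρ)) (trans (cong proj₁ s) (evalT-induced u ρ))
    QF-up (qfR r ts)  ρ s = subst (rel A r) (evalTs-induced ts ρ) s
    QF-up (qf¬ q)     ρ s = λ s′ → s (QF-down q ρ s′)
    QF-up (qf∧ q q′)  ρ (s , s′) = QF-up q ρ s , QF-up q′ ρ s′
    QF-up (qf∨ q q′)  ρ (inj₁ s) = inj₁ (QF-up q ρ s)
    QF-up (qf∨ q q′)  ρ (inj₂ s) = inj₂ (QF-up q′ ρ s)
    QF-down qf⊤        ρ s = s
    QF-down qf⊥        ρ s = s
    QF-down (qf≐ t u)  ρ s = ∈B-unique (trans (evalT-induced t ρ) (trans s (sym (evalT-induced u ρ))))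
    QF-down (qfR r ts) ρ s = subst (rel A r) (sym (evalTs-induced ts ρ)) s
    QF-down (qf¬ q)    ρ s = λ s′ → s (QF-up q ρ s′)
    QF-down (qf∧ q q′) ρ (s , s′) = QF-down q ρ s , QF-down q′ ρ s′
    QF-down (qf∨ q q′) ρ (inj₁ s) = inj₁ (QF-down q ρ s)
    QF-down (qf∨ q q′) ρ (inj₂ s) = inj₂ (QF-down q′ ρ s)

    existential-up : ∀ {k} {φ : Formula L k} → Existential L φ →
                     (ρ : Fin k → Carrier B̂) →
                     Sat L B̂ φ ρ → Sat L A φ (proj₁ ∘ ρ)
    existential-up (base q)           ρ s       = QF-up q ρ s
    existential-up (step {φ = φ} b) ρ (a , s) =
      proj₁ a , Sat-cong A φ (λ { fz → refl ; (fs i) → refl }) (existential-up b (ext L a ρ) s)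

  -- Classically, two structures generated by tuples γ and δ such that every
  -- quantifier-free fact about γ holds of δ are isomorphic, via t(γ) ↦ t(δ);
  -- negated facts are also transferred, which makes the map well defined and injective.
  module GeneratedIso (lem : ExcludedMiddle 0ℓ) (X Y : Structure L) {n : ℕ}
    (γ : Fin n → Carrier X) (δ : Fin n → Carrier Y)
    (γ-generates : ∀ x → ∃[ t ] evalT L X t γ ≡ x)
    (δ-generates : ∀ y → ∃[ t ] evalT L Y t δ ≡ y)
    (transfer : ∀ {θ : Formula L n} → QF L θ → Sat L X θ γ → Sat L Y θ δ) where

    termX : Carrier X → Term L n
    termX x = proj₁ (γ-generates x)

    termY : Carrier Y → Term L n
    termY y = proj₁ (δ-generates y)

    eq-transfer : ∀ t u → evalT L X t γ ≡ evalT L X u γ → evalT L Y t δ ≡ evalT L Y u δ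
    eq-transfer t u = transfer (qf≐ t u)

    eq-reflect : ∀ t u → evalT L Y t δ ≡ evalT L Y u δ → evalT L X t γ ≡ evalT L X u γ
    eq-reflect t u t≡u = em⇒dne lem (λ t≢u → transfer (qf¬ (qf≐ t u)) t≢u t≡u)

    h : Carrier X → Carrier Y
    h x = evalT L Y (termX x) δ

    h⁻¹ : Carrier Y → Carrier X
    h⁻¹ y = evalT L X (termY y) γ

    h-onTerms : ∀ t x → evalT L X t γ ≡ x → h x ≡ evalT L Y t δ
    h-onTerms t x t[γ]≡x = eq-transfer (termX x) t (trans (proj₂ (γ-generates x)) (sym t[γ]≡x))

    h-h⁻¹ : ∀ y → h (h⁻¹ y) ≡ y
    h-h⁻¹ y = trans (h-onTerms (termY y) (h⁻¹ y) refl) (proj₂ (δ-generates y))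

    h⁻¹-h : ∀ x → h⁻¹ (h x) ≡ x
    h⁻¹-h x = trans (eq-reflect (termY (h x)) (termX x) (proj₂ (δ-generates (h x))))
                    (proj₂ (γ-generates x))

    evalTs-termX : ∀ {m} (xs : Vec (Carrier X) m) → evalTs L X (mapVec termX xs) γ ≡ xs
    evalTs-termX []       = refl
    evalTs-termX (x ∷ xs) = cong₂ _∷_ (proj₂ (γ-generates x)) (evalTs-termX xs)

    evalTs-termX-Y : ∀ {m} (xs : Vec (Carrier X) m) → evalTs L Y (mapVec termX xs) δ ≡ mapVec h xs
    evalTs-termX-Y []       = refl
    evalTs-termX-Y (x ∷ xs) = cong (h x ∷_) (evalTs-termX-Y xs)

    relation-transfer : ∀ r xs → rel X r xs → rel Y r (mapVec h xs)
    relation-transfer r xs r[xs] = subst (rel Y r) (evalTs-termX-Y xs)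
      (transfer (qfR r _) (subst (rel X r) (sym (evalTs-termX xs)) r[xs]))

    relation-reflect : ∀ r xs → rel Y r (mapVec h xs) → rel X r xs
    relation-reflect r xs r[hxs] = em⇒dne lem λ ¬r[xs] →
      transfer (qf¬ (qfR r _)) (¬r[xs] ∘ subst (rel X r) (evalTs-termX xs))
        (subst (rel Y r) (sym (evalTs-termX-Y xs)) r[hxs])

    iso : _≅_ L X Y
    iso = record
      { bij     = mk↔ₛ′ h h⁻¹ h-h⁻¹ h⁻¹-h
      ; presFun = λ f xs →
          trans (h-onTerms (app f (mapVec termX xs)) _ (cong (fun X f) (evalTs-termX xs)))
                (cong (fun Y f) (evalTs-termX-Y xs))
      ; presRel = λ r xs → mk⇔ (relation-transfer r xs) (relation-reflect r xs)
      }

  module ScottConstruction (lem : ExcludedMiddle 0ℓ)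
    (funE : Enumeration Fun) (relE : Enumeration Rel)
    (A : Structure L) (n : ℕ) (g : Fin n → Carrier A)
    (g-generates : ∀ a → ∃[ t ] evalT L A t g ≡ a) where

    open Codes funE relE

    dne : {P : Set} → ¬ ¬ P → P
    dne = em⇒dne lem

    codes : Enumerator (ExCode n)
    codes = enum (ExCode-enumeration n)

    terms : Enumerator (Term L n)
    terms = enum (Term-enumeration n)

    TrueAtGens : ExCode n → Set
    TrueAtGens c = Sat L A ⟪ c ⟫ g

    clause : (c : ExCode n) → Dec (TrueAtGens c) → Formula L n
    clause c (yes _) = ⊤'
    clause c (no _)  = ⟪ c ⟫ᶜ

    clauseAt : Maybe (ExCode n) → Formula L n
    clauseAt nothing  = ⊤'
    clauseAt (just c) = clause c lem

    Δ : Formula L n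
    Δ = ⋀ (λ i → clauseAt (codes i))

    -- In context (y , x̄), with y unused: an existential formula true of x̄
    -- but false of g, i.e. a witness of ¬ Δ(x̄).
    refutation : (c : ExCode n) → Dec (TrueAtGens c) → Formula L (suc n)
    refutation c (yes _) = ⊥'
    refutation c (no _)  = subF (var ∘ fs) ⟪ c ⟫

    refutationAt : Maybe (ExCode n) → Formula L (suc n)
    refutationAt nothing  = ⊥'
    refutationAt (just c) = refutation c lem

    equationAt : Maybe (Term L n) → Formula L (suc n)
    equationAt nothing  = ⊥'
    equationAt (just t) = var fz ≐ wk t

    alternative : ℕ × ℕ → Formula L (suc n)
    alternative (zero  , j) = refutationAt (codes j)
    alternative (suc _ , j) = equationAt (terms j)

    -- ¬ Δ(x̄) ∨ y ∈ ⟨x̄⟩, as a single countable disjunction of existential formulas.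
    ¬Δ-or-generated : Formula L (suc n)
    ¬Δ-or-generated = ⋁ (λ i → alternative (unpair i))

    Φ : Sentence L
    Φ = ⋁ (λ _ → closeEx n Δ) ∧' ⋀ (λ _ → closeAll n (∀' ¬Δ-or-generated))

    clauseAt-universal : ∀ m → AllBlock L (QF L) (clauseAt m)
    clauseAt-universal nothing  = base qf⊤
    clauseAt-universal (just c) = clause-universal lem
      where
      clause-universal : (d : Dec (TrueAtGens c)) → AllBlock L (QF L) (clause c d)
      clause-universal (yes _) = base qf⊤
      clause-universal (no _)  = ⟪⟫ᶜ-universal c

    alternative-existential : ∀ p → Existential L (alternative p)
    alternative-existential (zero , j) = refutationAt-existential (codes j)
      where
      refutationAt-existential : ∀ m → Existential L (refutationAt m)
      refutationAt-existential nothing  = base qf⊥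
      refutationAt-existential (just c) = existential lem
        where
        existential : (d : Dec (TrueAtGens c)) → Existential L (refutation c d)
        existential (yes _) = base qf⊥
        existential (no _)  = subF-existential (var ∘ fs) (⟪⟫-existential c)
    alternative-existential (suc _ , j) with terms j
    ... | nothing = base qf⊥
    ... | just t  = base (qf≐ _ _)

    Φ-dΣ₂ : IsDΣ2 L Φ
    Φ-dΣ₂ = mk (mk _ λ _ → closeEx-block n (base (inj₂ Δ-Π₁)))
               (mk _ λ _ → closeAll-block n (step (base (inj₂ ¬Δ-or-generated-Σ₁))))
      where
      Δ-Π₁ : IsΠ1 L Δ
      Δ-Π₁ = mk _ (λ i → clauseAt-universal (codes i))
      ¬Δ-or-generated-Σ₁ : IsΣ1 L ¬Δ-or-generated
      ¬Δ-or-generated-Σ₁ = mk _ (λ i → alternative-existential (unpair i))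

    Δ-at-gens : Sat L A Δ g
    Δ-at-gens i = atGens (codes i)
      where
      atGens : ∀ m → Sat L A (clauseAt m) g
      atGens nothing  = tt
      atGens (just c) = clauseAtGens lem
        where
        clauseAtGens : (d : Dec (TrueAtGens c)) → Sat L A (clause c d) g
        clauseAtGens (yes _)    = tt
        clauseAtGens (no ¬c[g]) = ¬⇒⟪⟫ᶜ A c ¬c[g]

    -- The key property of Δ: if X ⊨ Δ(β), then every existential formula true
    -- of β in X is true of g in A; consequently no refutation holds of β, so
    -- X ⊨ ¬Δ-or-generated(y , β) means that y is generated by β.
    module Reflection (X : Structure L) (β : Fin n → Carrier X) (Δβ : Sat L X Δ β) where

      reflect-code : (c : ExCode n) → Sat L X ⟪ c ⟫ β → TrueAtGens c
      reflect-code c c[β] with at i codes-i≡c ← complete (ExCode-enumeration n) c =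
        fromClause lem (subst (λ m → Sat L X (clauseAt m) β) codes-i≡c (Δβ i))
        where
        fromClause : (d : Dec (TrueAtGens c)) → Sat L X (clause c d) β → TrueAtGens c
        fromClause (yes c[g]) _ = c[g]
        fromClause (no _) ¬c[β] = ⊥-elim (⟪⟫ᶜ⇒¬ X c ¬c[β] c[β])

      reflect : ∀ {φ} → Existential L φ → Sat L X φ β → Sat L A φ g
      reflect ex φ[β] with c , refl ← encodeEx ex = reflect-code c φ[β]

      module _ (y : Carrier X) where

        no-refutation : ∀ m → ¬ Sat L X (refutationAt m) (ext L y β)
        no-refutation nothing  ()
        no-refutation (just c) = none lem
          where
          none : (d : Dec (TrueAtGens c)) → ¬ Sat L X (refutation c d) (ext L y β)
          none (no ¬c[g]) s = ¬c[g] (reflect-code c (subF-to X (var ∘ fs) ⟪ c ⟫ (ext L y β) s))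

        generated : Sat L X ¬Δ-or-generated (ext L y β) → ∃[ t ] evalT L X t β ≡ y
        generated (i , s) = fromAlternative (unpair i) s
          where
          fromEquation : ∀ m → Sat L X (equationAt m) (ext L y β) → ∃[ t ] evalT L X t β ≡ y
          fromEquation (just t) y≡t = t , sym (trans y≡t (evalT-sub X (var ∘ fs) t (ext L y β)))
          fromAlternative : ∀ p → Sat L X (alternative p) (ext L y β) → ∃[ t ] evalT L X t β ≡ y
          fromAlternative (zero  , j) s = ⊥-elim (no-refutation (codes j) s)
          fromAlternative (suc _ , j) s = fromEquation (terms j) s

    generated-model≅A : (X : Structure L) (β : Fin n → Carrier X) → Sat L X Δ β →
                        (∀ x → ∃[ t ] evalT L X t β ≡ x) → _≅_ L X A
    generated-model≅A X β Δβ β-generates = GeneratedIso.iso lem X A β g β-generates g-generates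
      (λ q → Reflection.reflect X β Δβ (base q))

    module GeneratedSubstructure (β : Fin n → Carrier A) (Δβ : Sat L A Δ β) where

      Generated : Carrier A → Set
      Generated a = ∃[ t ] evalT L A t β ≡ a

      _∈⟨β⟩ : Carrier A → Set
      a ∈⟨β⟩ = does (lem {Generated a}) ≡ true

      termOf : Σ (Carrier A) _∈⟨β⟩ → Term L n
      termOf (_ , a∈) = proj₁ (does-true⇒ lem a∈)

      termOf-correct : ∀ x → evalT L A (termOf x) β ≡ proj₁ x
      termOf-correct (_ , a∈) = proj₂ (does-true⇒ lem a∈)

      evalTs-termOf : ∀ {m} (xs : Vec (Σ (Carrier A) _∈⟨β⟩) m) →
                      evalTs L A (mapVec termOf xs) β ≡ mapVec proj₁ xs
      evalTs-termOf []       = refl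
      evalTs-termOf (x ∷ xs) = cong₂ _∷_ (termOf-correct x) (evalTs-termOf xs)

      ⟨β⟩ : SubStr L A
      ⟨β⟩ = record
        { S      = λ a → does (lem {Generated a})
        ; closed = λ f xs →
            dec-true lem (app f (mapVec termOf xs) , cong (fun A f) (evalTs-termOf xs))
        }

      open SubstructureFacts A ⟨β⟩ using (∈B-unique; evalT-induced; QF-up; existential-up)

      γ : Fin n → Carrier (induced L A ⟨β⟩)
      γ i = β i , dec-true lem (var i , refl)

      γ-generates : ∀ x → ∃[ t ] evalT L (induced L A ⟨β⟩) t γ ≡ x
      γ-generates x = termOf x , ∈B-unique (trans (evalT-induced (termOf x) γ) (termOf-correct x))

      open GeneratedIso lem (induced L A ⟨β⟩) A γ g γ-generates g-generates
        (λ q θ[γ] → Reflection.reflect A β Δβ (base q) (QF-up q γ θ[γ])) using (iso; h-onTerms)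

      -- For b in ⟨β⟩ named by terms τ: φ(b) in A ⇒ φ[τ](β) ⇒ φ[τ](g) by the key
      -- property ⇒ φ(h b) in A, which the isomorphism h reflects to ⟨β⟩.
      ⟨β⟩≼₁A : _≼₁_ L {A} ⟨β⟩
      ⟨β⟩≼₁A φ ex b = mk⇔ existential-down (existential-up ex b)
        where
        τ : _ → Term L n
        τ = termOf ∘ b
        existential-down : Sat L A φ (proj₁ ∘ b) → Sat L (induced L A ⟨β⟩) φ b
        existential-down φ[b] =
          IsoTransfer.reflects iso φ b
            (Sat-cong A φ (λ i → sym (h-onTerms (τ i) (b i) (proj₂ (γ-generates (b i)))))
              (subF-to A τ φ g
                (Reflection.reflect A β Δβ (subF-existential τ ex)
                  (subF-from A τ φ β (Sat-cong A φ (sym ∘ termOf-correct ∘ b) φ[b])))))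

      generates : ¬ SelfReflective L A → ∀ a → Generated a
      generates notSR a =
        dne λ ¬gen → notSR (⟨β⟩ , (a , ¬gen ∘ does-true⇒ lem) , ⟨β⟩≼₁A , iso)

    alternative⇒ : {X : Structure L} {ρ : Fin (suc n) → Carrier X} (a j : ℕ) →
                   Sat L X (alternative (a , j)) ρ → Sat L X ¬Δ-or-generated ρ
    alternative⇒ {X} {ρ} a j s with i , ui≡aj ← unpair-surjective a j =
      i , subst (λ p → Sat L X (alternative p) ρ) (sym ui≡aj) s

    named⇒ : {β : Fin n → Carrier A} {y : Carrier A} (t : Term L n) →
             evalT L A t β ≡ y → Sat L A ¬Δ-or-generated (ext L y β)
    named⇒ {β} {y} t t[β]≡y with at j terms-j≡t ← complete (Term-enumeration n) t =
      alternative⇒ 1 j (subst (λ m → Sat L A (equationAt m) (ext L y β)) (sym terms-j≡t)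
                         (sym (trans (evalT-sub A (var ∘ fs) t (ext L y β)) t[β]≡y)))

    -- ¬ Δ(β) in A: some clause fails, and its refutation holds.
    refuted⇒ : {β : Fin n → Carrier A} {y : Carrier A} →
               ¬ Sat L A Δ β → Sat L A ¬Δ-or-generated (ext L y β)
    refuted⇒ {β} {y} ¬Δβ with i , ¬clause ← dne (λ ∄ → ¬Δβ (λ i → dne (¬∃⟶∀¬ ∄ i))) =
      alternative⇒ 0 i (refutes (codes i) ¬clause)
      where
      refutes : ∀ m → ¬ Sat L A (clauseAt m) β → Sat L A (refutationAt m) (ext L y β)
      refutes nothing  ¬⊤ = ⊥-elim (¬⊤ tt)
      refutes (just c) = refutes′ lem
        where
        refutes′ : (d : Dec (TrueAtGens c)) → ¬ Sat L A (clause c d) β →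
                   Sat L A (refutation c d) (ext L y β)
        refutes′ (yes _) ¬⊤     = ⊥-elim (¬⊤ tt)
        refutes′ (no _)  ¬¬c[β] =
          subF-from A (var ∘ fs) ⟪ c ⟫ (ext L y β) (dne (¬¬c[β] ∘ ¬⇒⟪⟫ᶜ A c))

    -- In A, each x̄ either fails Δ or (by non-self-reflectivity) generates A.
    A⊨¬Δ-or-generated : ¬ SelfReflective L A → ∀ β y → Sat L A ¬Δ-or-generated (ext L y β)
    A⊨¬Δ-or-generated notSR β y with lem {Sat L A Δ β}
    ... | yes Δβ = let t , t[β]≡y = GeneratedSubstructure.generates β Δβ notSR y
                   in named⇒ t t[β]≡y
    ... | no ¬Δβ = refuted⇒ ¬Δβ

    -- A ⊨ Φ: g witnesses ∃x̄ Δ, and the second conjunct is A⊨¬Δ-or-generated.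
    A⊨Φ : ¬ SelfReflective L A → (ρ : Fin 0 → Carrier A) → Sat L A Φ ρ
    A⊨Φ notSR ρ = (0 , closeEx-intro A n Δ ρ g Δ-at-gens)
                , λ _ → closeAll-intro A n (∀' ¬Δ-or-generated) ρ (A⊨¬Δ-or-generated notSR)

    -- A model of Φ has a tuple β with Δ(β), and β generates it, so it is a copy of A.
    model≅A : (X : Structure L) → Sat L X Φ (noVars L) → _≅_ L X A
    model≅A X ((_ , ∃Δ) , ∀generated) with β , Δβ ← closeEx-elim X n Δ (noVars L) ∃Δ =
      generated-model≅A X β Δβ λ y →
        Reflection.generated X β Δβ y (closeAll-elim X n _ (noVars L) (∀generated 0) β y)

    -- Φ characterises A up to isomorphism (among all models, countable or not).
    Φ-Scott : ¬ SelfReflective L A → ScottSentence L A Φ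
    Φ-Scott notSR X _ =
      mk⇔ (model≅A X) λ X≅A → IsoTransfer.reflects X≅A Φ (noVars L) (A⊨Φ notSR _)

theorem2p1 : ExcludedMiddle 0ℓ →
    (L : Lang) → CountableLang L →
    (A : Structure L) → CountableStr L A → FinitelyGenerated L A →
    ¬ SelfReflective L A →
    ∃[ φ ] (IsDΣ2 L φ × ScottSentence L A φ)
theorem2p1 lem L (countableFun , countableRel) A _ (n , g , g-generates) notSR =
  Φ , Φ-dΣ₂ , Φ-Scott notSR
  where
  open ScottConstruction L lem (countable⇒enumeration lem countableFun)
                               (countable⇒enumeration lem countableRel) A n g g-generates
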